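{- Let $\lambda,\mu$ be strict partitions with $\mu\subseteq\lambda$, and let $\mathcal{C},\mathcal{C}'$ be configurations for $\lambda/\mu$ such that $\mathcal{C}'$ is obtained from $\mathcal{C}$ by exchanging the $0$'s of two rows $a$ and $b$, where in $\mathcal{C}$ row $a$ has type $(o,o)$ and row $b$ has type $(\emptyset,o)$, and in $\mathcal{C}'$ row $a$ has type $(\emptyset,e)$ and row $b$ has type $(o,\emptyset)$. Then $\kappa(\mathcal{C}')\le\kappa(\mathcal{C})$.
   Context: Let $S(\lambda)$ be the shifted diagram of $\lambda$ (row $i$ of the Young diagram shifted $i-1$ squares right). A configuration $\mathcal{C}$ of $0$'s for $\lambda/\mu$ assigns to each row $i$ an integer $z_i$ with $0\le z_i\le\lambda_i$ (the leftmost $z_i$ squares of row $i$ are filled with $0$, the other $\lambda_i-z_i$ squares are blank), such that the nonzero $z_i$'s, arranged in decreasing order, are exactly the parts of $\mu$. Exchanging the $0$'s of rows $a\ne b$ means replacing $(z_a,z_b)$ by $(z_b,z_a)$ (when this is again a configuration). Row types: $(e,e)$: $z_i>0$ even and $\lambda_i-z_i>0$ even; $(e,o)$: $z_i>0$ even, $\lambda_i-z_i$ odd; $(o,e)$: $z_i$ odd, $\lambda_i-z_i>0$ even; $(o,o)$: $z_i$ odd, $\lambda_i-z_i$ odd; $(\emptyset,e)$: $z_i=0$, $\lambda_i$ even; $(\emptyset,o)$: $z_i=0$, $\lambda_i$ odd; $(e,\emptyset)$: $z_i=\lambda_i$ even; $(o,\emptyset)$: $z_i=\lambda_i$ odd.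 Let $o_r$ (resp. $e_r$) be the number of rows with $z_i=0$ and $\lambda_i$ odd (resp. even), and $o_s$ (resp. $e_s$) the number of rows with $z_i>0$ and $\lambda_i-z_i$ odd (resp. even and nonzero). Define $\kappa(\mathcal{C})=o_s+2e_s+\max\big(o_r,\ e_r+((e_r+o_r)\bmod 2)\big)$. -}

module Defs where

open import Data.Nat using (ℕ; zero; suc; _+_; _*_; _∸_; _≤_; _<_; _⊔_; _%_; _≡ᵇ_)
open import Data.Bool using (Bool; true; false; if_then_else_; _∧_; not)
open import Data.Fin using (Fin; toℕ) renaming (_<_ to _<ᶠ_)
open import Data.List using (List; []; _∷_; length; map; filter; allFin)
open import Data.Nat.ListAction using (sum)
open import Data.List.Relation.Unary.All using (All)
open import Data.List.Relation.Unary.Linked using (Linked)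
open import Data.List.Relation.Binary.Permutation.Propositional using (_↭_)
open import Data.Product using (_×_)
open import Relation.Binary.PropositionalEquality using (_≡_; _≢_)
open import Relation.Nullary using (¬_)
open import Relation.Unary using (Decidable)
open import Data.Nat.Properties using (_≟_)

Even : ℕ → Set
Even k = k % 2 ≡ 0

Odd : ℕ → Set
Odd k = k % 2 ≡ 1

oddᵇ : ℕ → Bool
oddᵇ k = (k % 2) ≡ᵇ 1

isZeroᵇ : ℕ → Bool
isZeroᵇ k = k ≡ᵇ 0

-- A strict partition with n (positive) parts, λ₁ > λ₂ > ... > λₙ > 0,
-- given as a function on row indices Fin n (row i ↦ λ_{i+1}).
IsStrictPartitionFn : {n : ℕ} → (Fin n → ℕ) → Set
IsStrictPartitionFn {n} lam =
  ((i : Fin n) → 0 < lam i) × ((i j : Fin n) → i <ᶠ j → lam j < lam i)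

IsStrictPartition : List ℕ → Set
IsStrictPartition mu = All (0 <_) mu × Linked (λ x y → y < x) mu

partAt : List ℕ → ℕ → ℕ
partAt [] _ = 0
partAt (x ∷ _) zero = x
partAt (_ ∷ xs) (suc i) = partAt xs i

Contained : {n : ℕ} → List ℕ → (Fin n → ℕ) → Set
Contained {n} mu lam = length mu ≤ n × ((i : Fin n) → partAt mu (toℕ i) ≤ lam i)

nonzero? : Decidable (λ (k : ℕ) → ¬ (k ≡ 0))
nonzero? k = Relation.Nullary.¬? (k ≟ 0)
  where import Relation.Nullary

-- A configuration of 0's for λ/μ: z i = number of 0's in row i.
IsConfiguration : {n : ℕ} → (Fin n → ℕ) → List ℕ → (Fin n → ℕ) → Set
IsConfiguration {n} lam mu z =
  ((i : Fin n) → z i ≤ lam i) ×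
  (filter nonzero? (map z (allFin n)) ↭ mu)

Exchanged : {n : ℕ} → (Fin n → ℕ) → (Fin n → ℕ) → Fin n → Fin n → Set
Exchanged {n} z z' a b =
  a ≢ b × z' a ≡ z b × z' b ≡ z a × ((i : Fin n) → i ≢ a → i ≢ b → z' i ≡ z i)

TypeOO : {n : ℕ} → (Fin n → ℕ) → (Fin n → ℕ) → Fin n → Set
TypeOO lam z i = Odd (z i) × Odd (lam i ∸ z i)

TypeEmptyO : {n : ℕ} → (Fin n → ℕ) → (Fin n → ℕ) → Fin n → Set
TypeEmptyO lam z i = z i ≡ 0 × Odd (lam i)

TypeEmptyE : {n : ℕ} → (Fin n → ℕ) → (Fin n → ℕ) → Fin n → Set
TypeEmptyE lam z i = z i ≡ 0 × Even (lam i)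

TypeOEmpty : {n : ℕ} → (Fin n → ℕ) → (Fin n → ℕ) → Fin n → Set
TypeOEmpty lam z i = z i ≡ lam i × Odd (lam i)

countRows : {n : ℕ} → (Fin n → Bool) → ℕ
countRows {n} p = sum (map (λ i → if p i then 1 else 0) (allFin n))

oR eR oS eS : {n : ℕ} → (Fin n → ℕ) → (Fin n → ℕ) → ℕ
oR lam z = countRows (λ i → isZeroᵇ (z i) ∧ oddᵇ (lam i))
eR lam z = countRows (λ i → isZeroᵇ (z i) ∧ not (oddᵇ (lam i)))
oS lam z = countRows (λ i → not (isZeroᵇ (z i)) ∧ oddᵇ (lam i ∸ z i))
eS lam z = countRows (λ i → not (isZeroᵇ (z i)) ∧ not (oddᵇ (lam i ∸ z i))
                            ∧ not (isZeroᵇ (lam i ∸ z i)))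

κ : {n : ℕ} → (Fin n → ℕ) → (Fin n → ℕ) → ℕ
κ lam z = oS lam z + 2 * eS lam z + (oR lam z ⊔ (eR lam z + ((eR lam z + oR lam z) % 2)))

-- Exchanging the 0's of rows a and b only changes the contributions of these two
-- rows to the four counts: row a turns from type (o,o) into type (∅,e) and row b
-- from type (∅,o) into type (o,∅), so o_s and o_r each drop by one, e_r grows by
-- one and e_s is unchanged. Hence e_r + o_r keeps its parity, and the maximum in κ
-- grows by at most one, which the drop of o_s pays for.
module Submission where

open import Defs
open import Algebra.Properties.CommutativeSemigroup using (x∙yz≈y∙xz)
import Algebra.Properties.CommutativeMonoid.Sum as MonoidSum
open import Data.Bool using (Bool; true; false; if_then_else_; _∧_; not)
open import Data.Fin using (Fin; zero; suc; punchIn)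
open import Data.Fin.Properties using (punchInᵢ≢i) renaming (_≟_ to _≟ᶠ_)
open import Data.List using (List; tabulate)
open import Data.List.Properties using (map-tabulate)
open import Data.Nat using (ℕ; suc; _+_; _*_; _∸_; _⊔_; _%_; _≤_; s≤s)
open import Data.Nat.ListAction using (sum)
open import Data.Nat.Properties
open import Data.Product using (_×_; _,_; proj₁; proj₂)
open import Data.Vec.Functional using (removeAt; updateAt)
open import Data.Vec.Functional.Properties using (updateAt-updates; updateAt-minimal)
open import Function using (_∘_; const)
open import Relation.Binary.PropositionalEquality
open import Relation.Nullary using (yes; no)

open MonoidSum +-0-commutativeMonoid using (sum-remove; sum-cong-≗) renaming (sum to ∑)

+-swap : ∀ x y z → x + (y + z) ≡ y + (x + z)
+-swap = x∙yz≈y∙xz +-commutativeSemigroup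

indicator : Bool → ℕ
indicator b = if b then 1 else 0

sum-tabulate : ∀ {n} (f : Fin n → ℕ) → sum (tabulate f) ≡ ∑ f
sum-tabulate {ℕ.zero} f = refl
sum-tabulate {suc n}  f = cong (f zero +_) (sum-tabulate (f ∘ suc))

countRows≡∑ : ∀ {n} (p : Fin n → Bool) → countRows p ≡ ∑ (indicator ∘ p)
countRows≡∑ p =
  trans (cong sum (map-tabulate (λ i → i) (indicator ∘ p))) (sum-tabulate (indicator ∘ p))

countRows-update : ∀ {n} (p q : Fin n → Bool) (a : Fin n) → (∀ i → i ≢ a → p i ≡ q i)
  → indicator (q a) + countRows p ≡ indicator (p a) + countRows q
countRows-update {suc n} p q a agree = begin
  indicator (q a) + countRows p                ≡⟨ cong (indicator (q a) +_) (split p) ⟩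
  indicator (q a) + (indicator (p a) + rest p) ≡⟨ +-swap (indicator (q a)) (indicator (p a)) (rest p) ⟩
  indicator (p a) + (indicator (q a) + rest p) ≡⟨ cong (λ r → indicator (p a) + (indicator (q a) + r)) rest-agree ⟩
  indicator (p a) + (indicator (q a) + rest q) ≡⟨ cong (indicator (p a) +_) (split q) ⟨
  indicator (p a) + countRows q                ∎
  where
  open ≡-Reasoning
  rest : (Fin (suc n) → Bool) → ℕ
  rest r = ∑ (removeAt (indicator ∘ r) a)
  split : ∀ r → countRows r ≡ indicator (r a) + rest r
  split r = trans (countRows≡∑ r) (sum-remove (indicator ∘ r))
  rest-agree : rest p ≡ rest q
  rest-agree = sum-cong-≗ (λ j → cong indicator (agree (punchIn a j) (punchInᵢ≢i a j)))

countRows-update₂ : ∀ {n} (p q : Fin n → Bool) {a b : Fin n} → a ≢ b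
  → (∀ i → i ≢ a → i ≢ b → p i ≡ q i)
  → indicator (q a) + (indicator (q b) + countRows p)
    ≡ indicator (p a) + (indicator (p b) + countRows q)
countRows-update₂ p q {a} {b} a≢b agree = begin
  indicator (q a) + (indicator (q b) + countRows p) ≡⟨ +-swap (indicator (q a)) (indicator (q b)) (countRows p) ⟩
  indicator (q b) + (indicator (q a) + countRows p) ≡⟨ cong (indicator (q b) +_) p⇝m ⟩
  indicator (q b) + (indicator (p a) + countRows m) ≡⟨ +-swap (indicator (q b)) (indicator (p a)) (countRows m) ⟩
  indicator (p a) + (indicator (q b) + countRows m) ≡⟨ cong (indicator (p a) +_) m⇝q ⟩
  indicator (p a) + (indicator (p b) + countRows q) ∎
  where
  open ≡-Reasoning
  m : Fin _ → Bool
  m = updateAt p a (const (q a))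
  m-off-a : ∀ i → i ≢ a → m i ≡ p i
  m-off-a i i≢a = updateAt-minimal i a p i≢a
  p⇝m : indicator (q a) + countRows p ≡ indicator (p a) + countRows m
  p⇝m = subst (λ x → indicator x + countRows p ≡ indicator (p a) + countRows m)
          (updateAt-updates a p)
          (countRows-update p m a (λ i i≢a → sym (m-off-a i i≢a)))
  m-off-b : ∀ i → i ≢ b → m i ≡ q i
  m-off-b i i≢b with i ≟ᶠ a
  ... | yes refl = updateAt-updates a p
  ... | no i≢a   = trans (m-off-a i i≢a) (agree i i≢a i≢b)
  m⇝q : indicator (q b) + countRows m ≡ indicator (p b) + countRows q
  m⇝q = subst (λ x → indicator (q b) + countRows m ≡ indicator x + countRows q)
          (m-off-a b (a≢b ∘ sym))
          (countRows-update m q b m-off-b)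

count-exchange : ∀ {n} {lam z z' : Fin n → ℕ} {a b : Fin n} → Exchanged z z' a b
  → (t : ℕ → ℕ → Bool) {x y x' y' : Bool}
  → t (lam a) (z a) ≡ x → t (lam b) (z b) ≡ y → t (lam a) (z' a) ≡ x' → t (lam b) (z' b) ≡ y'
  → indicator x' + (indicator y' + countRows (λ i → t (lam i) (z i)))
    ≡ indicator x + (indicator y + countRows (λ i → t (lam i) (z' i)))
count-exchange {lam = lam} (a≢b , _ , _ , unchanged) t refl refl refl refl =
  countRows-update₂ _ _ a≢b (λ i i≢a i≢b → cong (t (lam i)) (sym (unchanged i i≢a i≢b)))

RowTests : Set
RowTests = Bool × Bool × Bool × Bool

-- The tests counted by o_s, e_s, o_r and e_r, in this order, in terms of
-- whether z_i = 0, λ_i is odd, λ_i − z_i is odd and λ_i − z_i = 0.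
rowTally : (zero? odd? rest-odd? rest-zero? : Bool) → RowTests
rowTally zero? odd? rest-odd? rest-zero? =
  not zero? ∧ rest-odd? , not zero? ∧ not rest-odd? ∧ not rest-zero? , zero? ∧ odd? , zero? ∧ not odd?

rowTests : ℕ → ℕ → RowTests
rowTests l y = rowTally (isZeroᵇ y) (oddᵇ l) (oddᵇ (l ∸ y)) (isZeroᵇ (l ∸ y))

oddᵇ-odd : ∀ {k} → Odd k → oddᵇ k ≡ true
oddᵇ-odd k%2≡1 rewrite k%2≡1 = refl

oddᵇ-even : ∀ {k} → Even k → oddᵇ k ≡ false
oddᵇ-even k%2≡0 rewrite k%2≡0 = refl

isZeroᵇ-odd : ∀ {k} → Odd k → isZeroᵇ k ≡ false
isZeroᵇ-odd {suc k} _ = refl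

module _ {n} (lam z : Fin n → ℕ) (i : Fin n) where

  rowTests-OO : TypeOO lam z i → rowTests (lam i) (z i) ≡ (true , false , false , false)
  rowTests-OO (z-odd , rest-odd) =
    cong₂ (λ zero? rest-odd? → rowTally zero? (oddᵇ (lam i)) rest-odd? (isZeroᵇ (lam i ∸ z i)))
          (isZeroᵇ-odd {z i} z-odd) (oddᵇ-odd {lam i ∸ z i} rest-odd)

  rowTests-EmptyO : TypeEmptyO lam z i → rowTests (lam i) (z i) ≡ (false , false , true , false)
  rowTests-EmptyO (z≡0 , lam-odd) rewrite z≡0 =
    cong (λ odd? → rowTally true odd? odd? (isZeroᵇ (lam i))) (oddᵇ-odd {lam i} lam-odd)

  rowTests-EmptyE : TypeEmptyE lam z i → rowTests (lam i) (z i) ≡ (false , false , false , true)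
  rowTests-EmptyE (z≡0 , lam-even) rewrite z≡0 =
    cong (λ odd? → rowTally true odd? odd? (isZeroᵇ (lam i))) (oddᵇ-even {lam i} lam-even)

  rowTests-OEmpty : TypeOEmpty lam z i → rowTests (lam i) (z i) ≡ (false , false , false , false)
  rowTests-OEmpty (z≡lam , lam-odd) rewrite z≡lam =
    cong₂ (λ zero? rest → rowTally zero? (oddᵇ (lam i)) (oddᵇ rest) (isZeroᵇ rest))
          (isZeroᵇ-odd {lam i} lam-odd) (n∸n≡0 (lam i))

κ-of : ℕ → ℕ → ℕ → ℕ → ℕ
κ-of os es or er = os + 2 * es + (or ⊔ (er + ((er + or) % 2)))

⊔-suc-bound : ∀ m k → m ⊔ suc k ≤ suc (suc m ⊔ k)
⊔-suc-bound m k = ≤-trans (⊔-monoˡ-≤ (suc k) (n≤1+n m)) (s≤s (⊔-monoˡ-≤ k (n≤1+n m)))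

κ-of-transfer : ∀ os es or er → κ-of os es or (suc er) ≤ κ-of (suc os) es (suc or) er
κ-of-transfer os es or er = begin
  os + 2 * es + (or ⊔ (suc er + (suc er + or) % 2))
    ≡⟨ cong (λ s → os + 2 * es + (or ⊔ suc (er + s % 2))) (sym (+-suc er or)) ⟩
  os + 2 * es + (or ⊔ suc (er + p))                  ≤⟨ +-monoʳ-≤ (os + 2 * es) (⊔-suc-bound or (er + p)) ⟩
  os + 2 * es + suc (suc or ⊔ (er + p))              ≡⟨ +-suc (os + 2 * es) _ ⟩
  suc os + 2 * es + (suc or ⊔ (er + p))              ∎
  where
  open ≤-Reasoning
  p : ℕ
  p = (er + suc or) % 2

κ-of-exchange : ∀ {os es or er os' es' or' er'}
  → os ≡ suc os' → es ≡ es' → or ≡ suc or' → suc er ≡ er'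
  → κ-of os' es' or' er' ≤ κ-of os es or er
κ-of-exchange {es = es} {er = er} {os' = os'} {or' = or'} refl refl refl refl =
  κ-of-transfer os' es or' er

mainTheorem10 : (n : ℕ) (lam : Fin n → ℕ) (mu : List ℕ)
    → IsStrictPartitionFn lam → IsStrictPartition mu → Contained mu lam
    → (z z' : Fin n → ℕ) (a b : Fin n)
    → IsConfiguration lam mu z → IsConfiguration lam mu z'
    → Exchanged z z' a b
    → TypeOO lam z a → TypeEmptyO lam z b
    → TypeEmptyE lam z' a → TypeOEmpty lam z' b
    → κ lam z' ≤ κ lam z
mainTheorem10 n lam mu _ _ _ z z' a b _ _ exchanged oo-a ∅o-b ∅e-a o∅-b =
  κ-of-exchange (count proj₁) (count (proj₁ ∘ proj₂))
                (count (proj₁ ∘ proj₂ ∘ proj₂)) (count (proj₂ ∘ proj₂ ∘ proj₂))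
  where
  -- For π a projection of RowTests, countAt z π is definitionally oS, eS, oR or
  -- eR of lam z, so κ lam z is κ-of applied to the four countAt z π.
  countAt : (Fin n → ℕ) → (RowTests → Bool) → ℕ
  countAt y π = countRows (λ i → π (rowTests (lam i) (y i)))
  count : (π : RowTests → Bool)
    → indicator (π (false , false , false , true)) + (indicator (π (false , false , false , false)) + countAt z π)
      ≡ indicator (π (true , false , false , false)) + (indicator (π (false , false , true , false)) + countAt z' π)
  count π = count-exchange exchanged (λ l y → π (rowTests l y))
    (cong π (rowTests-OO lam z a oo-a)) (cong π (rowTests-EmptyO lam z b ∅o-b))
    (cong π (rowTests-EmptyE lam z' a ∅e-a)) (cong π (rowTests-OEmpty lam z' b o∅-b))
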